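{- Let $m,n\in\mathbb{N}$. Let $\vec{K}_{m,m}$ be the complete bipartite digraph with vertex set $V=V_1\cup V_2$, $V_1=\{v_1^{(1)},\dots,v_m^{(1)}\}$, $V_2=\{v_1^{(2)},\dots,v_m^{(2)}\}$, and edge set $V_1\times V_2$, and let $\Gamma_{n+1}(\vec{K}_{m,m})$ be the set of monotone $(n+1)$-colorings of $\vec{K}_{m,m}$. Let $\mathfrak{a}=(A,=)$ be an antichain with $A=\{a_1,\dots,a_m\}$ and $\mathfrak{c}=(C,\le)$ a chain with $C=\{c_1,\dots,c_n\}$ (disjoint from $A$), $c_i\le c_j\iff i\le j$, and let $\mathfrak{A\!C}^{\bullet}_{m,n}$ be the set of proper mergings of $\mathfrak{a}$ and $\mathfrak{c}$. For $\gamma\in\Gamma_{n+1}(\vec{K}_{m,m})$ define $R_\gamma\subseteq A\times C$ and $S_\gamma\subseteq C\times A$ by \[ a_i\,R_\gamma\,c_j\iff \gamma(v_i^{(1)})=k\text{ and } n+2-k\le j\le n,\qquad c_j\,S_\gamma\,a_i\iff \gamma(v_i^{(2)})=k\text{ and } 1\le j\le n+1-k, \] for $1\le i\le m$, $1\le j\le n$. Then the map $\gamma\mapsto(R_\gamma,S_\gamma)$ is a bijection from $\Gamma_{n+1}(\vec{K}_{m,m})$ onto $\mathfrak{A\!C}^{\bullet}_{m,n}$.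
   Context: A $k$-coloring of a digraph $(V,\vec E)$ is a map $\gamma:V\to\{1,\dots,k\}$; it is monotone if $(v,w)\in\vec E$ implies $\gamma(v)\le\gamma(w)$. An antichain $(A,=)$ is a set ordered by equality. A quasi-order is a reflexive, transitive binary relation. For disjoint quasi-ordered sets $(P,\leftarrow_P)$, $(Q,\leftarrow_Q)$ and relations $R\subseteq P\times Q$, $S\subseteq Q\times P$, define $\leftarrow_{R,S}$ on $P\cup Q$ by: $p\leftarrow_{R,S}q$ iff $p\leftarrow_P q$ or $p\leftarrow_Q q$ or $(p,q)\in R$ or $(p,q)\in S$. $(R,S)$ is a merging of $P$ and $Q$ if $\leftarrow_{R,S}$ is a quasi-order on $P\cup Q$, and a proper merging if additionally $R\cap S^{ -1}=\emptyset$. -}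

module Defs where

open import Data.Nat using (ℕ; suc; _+_; _∸_) renaming (_≤_ to _≤ℕ_; _≤?_ to _≤ℕ?_)
open import Data.Fin using (Fin; toℕ) renaming (_≤_ to _≤F_)
open import Data.Sum using (_⊎_; inj₁; inj₂)
open import Data.Product using (_×_; _,_; Σ)
open import Data.Bool using (Bool; true)
open import Data.Unit using (⊤)
open import Data.Empty using (⊥)
open import Relation.Nullary using (¬_)
open import Relation.Nullary.Decidable using (⌊_⌋)
open import Relation.Binary.PropositionalEquality using (_≡_)

-- A k-coloring of a digraph with vertex type V is a map V → Fin k
-- (colour c : Fin k stands for the colour toℕ c + 1 ∈ {1,…,k}).
-- It is monotone if every edge (v,w) satisfies γ v ≤ γ w.
Monotone : {V : Set} (E : V → V → Set) {k : ℕ} → (V → Fin k) → Set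
Monotone {V} E γ = (v w : V) → E v w → γ v ≤F γ w

-- The complete bipartite digraph K⃗_{m,m}: vertices V₁ ⊎ V₂ with
-- V₁ = V₂ = Fin m (inj₁ i = v_i^(1), inj₂ i = v_i^(2)), edges V₁ × V₂.
KVert : ℕ → Set
KVert m = Fin m ⊎ Fin m

KEdge : (m : ℕ) → KVert m → KVert m → Set
KEdge m (inj₁ _) (inj₂ _) = ⊤
KEdge m (inj₁ _) (inj₁ _) = ⊥
KEdge m (inj₂ _) (inj₁ _) = ⊥
KEdge m (inj₂ _) (inj₂ _) = ⊥

Coloring : ℕ → ℕ → Set
Coloring m n = KVert m → Fin (suc n)

IsMonotoneColoring : (m n : ℕ) → Coloring m n → Set
IsMonotoneColoring m n γ = Monotone (KEdge m) γ

-- Merging of the antichain a = (A,=), A = {a_1..a_m} ≅ Fin m, and the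
-- chain c = (C,≤), C = {c_1..c_n} ≅ Fin n with c_i ≤ c_j iff i ≤ j.

RelAC : ℕ → ℕ → Set
RelAC m n = Fin m → Fin n → Bool

RelCA : ℕ → ℕ → Set
RelCA m n = Fin n → Fin m → Bool

Merged : {m n : ℕ} → RelAC m n → RelCA m n → Fin m ⊎ Fin n → Fin m ⊎ Fin n → Set
Merged R S (inj₁ i) (inj₁ i') = i ≡ i'
Merged R S (inj₂ j) (inj₂ j') = j ≤F j'
Merged R S (inj₁ i) (inj₂ j) = R i j ≡ true
Merged R S (inj₂ j) (inj₁ i) = S j i ≡ true

IsQuasiOrder : {X : Set} → (X → X → Set) → Set
IsQuasiOrder {X} _≼_ = ((x : X) → x ≼ x) × ((x y z : X) → x ≼ y → y ≼ z → x ≼ z)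

IsMerging : {m n : ℕ} → RelAC m n → RelCA m n → Set
IsMerging R S = IsQuasiOrder (Merged R S)

IsProperMerging : {m n : ℕ} → RelAC m n → RelCA m n → Set
IsProperMerging {m} {n} R S =
  IsMerging R S × ((i : Fin m) (j : Fin n) → ¬ (R i j ≡ true × S j i ≡ true))

-- The map γ ↦ (R_γ , S_γ), written with 1-based indices:
-- k = toℕ (γ v) + 1 is the colour, j = toℕ j' + 1 the chain index.
--   a_i R_γ c_j  iff  n + 2 - k ≤ j ≤ n      (j ≤ n automatic)
--   c_j S_γ a_i  iff  1 ≤ j ≤ n + 1 - k      (1 ≤ j automatic)

colour : {m n : ℕ} → Coloring m n → KVert m → ℕ
colour γ v = suc (toℕ (γ v))

Rγ : {m n : ℕ} → Coloring m n → RelAC m n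
Rγ {m} {n} γ i j = ⌊ (n + 2 ∸ colour γ (inj₁ i)) ≤ℕ? suc (toℕ j) ⌋

Sγ : {m n : ℕ} → Coloring m n → RelCA m n
Sγ {m} {n} γ j i = ⌊ suc (toℕ j) ≤ℕ? (n + 1 ∸ colour γ (inj₂ i)) ⌋

_≗C_ : {m n : ℕ} → Coloring m n → Coloring m n → Set
γ ≗C δ = ∀ v → γ v ≡ δ v

SamePair : {m n : ℕ} → RelAC m n × RelCA m n → RelAC m n × RelCA m n → Set
SamePair {m} {n} (R , S) (R' , S') =
  ((i : Fin m) (j : Fin n) → R i j ≡ R' i j) × ((j : Fin n) (i : Fin m) → S j i ≡ S' j i)

Φ : {m n : ℕ} → Coloring m n → RelAC m n × RelCA m n
Φ γ = Rγ γ , Sγ γ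

-- Read the colour k of a vertex through its reversal t = n + 1 − k ∈ {0,…,n}.
-- Then a_i R_γ c_j holds iff t(v_i^(1)) ≤ j − 1 and c_j S_γ a_i iff j − 1 < t(v_i^(2)):
-- every row of R_γ is an up-set and every column of S_γ a down-set of the chain,
-- cut at the reversed colours.  Conversely, in any merging the rows of R are
-- up-sets and the columns of S down-sets by transitivity, and each such set is
-- cut at a unique point.  So pairs (R , S) with cut rows and columns correspond
-- bijectively to colourings, and for such a pair being a proper merging amounts to
-- t(v_i'^(2)) ≤ t(v_i^(1)) for all i , i', which is monotonicity of the colouring.
module Submission where

open import Defs
open import Data.Bool using (Bool; true; false)
open import Data.Bool.Properties using (¬-not)
open import Data.Empty using (⊥)
open import Data.Fin using (Fin; zero; suc; toℕ; fromℕ<; opposite)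
open import Data.Fin.Properties
  using (toℕ-injective; toℕ-fromℕ<; toℕ≤pred[n]; opposite-prop; opposite-involutive)
open import Data.Nat using (ℕ; _+_; _∸_; _≤_; _<_; z≤n; s≤s; s≤s⁻¹; _≤?_; _<?_)
open import Data.Nat.Properties
  using (≤-refl; ≤-trans; ≤-reflexive; ≤-antisym; <⇒≤; <-irrefl; <-≤-trans; ≤-<-trans;
         ≮⇒≥; +-comm; +-∸-assoc; ∸-monoʳ-≤)
open import Data.Product using (_×_; _,_; Σ; Σ-syntax; proj₁; proj₂)
open import Data.Sum using (inj₁; inj₂; [_,_]′)
open import Data.Unit using (tt)
open import Function using (_∘_; flip)
open import Function.Bundles using (mk⇔)
open import Relation.Nullary using (Dec; yes; no; does; contradiction)
open import Relation.Nullary.Decidable using (⌊_⌋; isYes≗does; dec-true; does-⇔)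
open import Relation.Binary.PropositionalEquality
  using (_≡_; refl; sym; trans; cong; subst; module ≡-Reasoning)

private
  variable
    m n : ℕ

⌊⌋≡true⇒ : {P : Set} (p? : Dec P) → ⌊ p? ⌋ ≡ true → P
⌊⌋≡true⇒ (yes p) _ = p
⌊⌋≡true⇒ (no _) ()

⇒⌊⌋≡true : {P : Set} (p? : Dec P) → P → ⌊ p? ⌋ ≡ true
⇒⌊⌋≡true p? p = trans (isYes≗does p?) (dec-true p? p)

⌊≤?⌋-suc : ∀ a b → ⌊ ℕ.suc a ≤? ℕ.suc b ⌋ ≡ ⌊ a ≤? b ⌋
⌊≤?⌋-suc a b = begin
  ⌊ ℕ.suc a ≤? ℕ.suc b ⌋   ≡⟨ isYes≗does _ ⟩
  does (ℕ.suc a ≤? ℕ.suc b) ≡⟨ does-⇔ (mk⇔ s≤s⁻¹ s≤s) (ℕ.suc a ≤? ℕ.suc b) (a ≤? b) ⟩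
  does (a ≤? b)            ≡⟨ isYes≗does _ ⟨
  ⌊ a ≤? b ⌋               ∎
  where open ≡-Reasoning

opposite-anti-≤ : {i j : Fin n} → toℕ i ≤ toℕ j → toℕ (opposite j) ≤ toℕ (opposite i)
opposite-anti-≤ {n} {i} {j} i≤j =
  subst (_≤ toℕ (opposite i)) (sym (opposite-prop j))
    (subst (n ∸ ℕ.suc (toℕ j) ≤_) (sym (opposite-prop i)) (∸-monoʳ-≤ n (s≤s i≤j)))

opposite-injective : {i j : Fin n} → opposite i ≡ opposite j → i ≡ j
opposite-injective {i = i} {j} eq =
  trans (sym (opposite-involutive i)) (trans (cong opposite eq) (opposite-involutive j))

_IsUpCutAt_ : (Fin n → Bool) → Fin (ℕ.suc n) → Set
f IsUpCutAt t = ∀ j → f j ≡ ⌊ toℕ t ≤? toℕ j ⌋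

_IsDownCutAt_ : (Fin n → Bool) → Fin (ℕ.suc n) → Set
g IsDownCutAt t = ∀ j → g j ≡ ⌊ toℕ j <? toℕ t ⌋

pointBelow : (t : Fin (ℕ.suc n)) {a : ℕ} → a < toℕ t → Σ[ j ∈ Fin n ] toℕ j ≡ a
pointBelow t a<t = fromℕ< (<-≤-trans a<t (toℕ≤pred[n] t)) , toℕ-fromℕ< _

upCut-unique : {f : Fin n → Bool} {t t′ : Fin (ℕ.suc n)} →
               f IsUpCutAt t → f IsUpCutAt t′ → t ≡ t′
upCut-unique ft ft′ = toℕ-injective (≤-antisym (cut-≤ ft ft′) (cut-≤ ft′ ft))
  where
  cut-≤ : ∀ {f t t′} → f IsUpCutAt t → f IsUpCutAt t′ → toℕ t ≤ toℕ t′
  cut-≤ {f = f} {t} {t′} ft ft′ = ≮⇒≥ λ t′<t →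
    let (j , j≡t′) = pointBelow t t′<t
        fj : f j ≡ true
        fj = trans (ft′ j) (⇒⌊⌋≡true _ (≤-reflexive (sym j≡t′)))
        t≤j = ⌊⌋≡true⇒ (toℕ t ≤? toℕ j) (trans (sym (ft j)) fj)
    in <-irrefl refl (<-≤-trans t′<t (subst (toℕ t ≤_) j≡t′ t≤j))

downCut-unique : {g : Fin n → Bool} {t t′ : Fin (ℕ.suc n)} →
                 g IsDownCutAt t → g IsDownCutAt t′ → t ≡ t′
downCut-unique gt gt′ = toℕ-injective (≤-antisym (cut-≤ gt gt′) (cut-≤ gt′ gt))
  where
  cut-≤ : ∀ {g t t′} → g IsDownCutAt t → g IsDownCutAt t′ → toℕ t ≤ toℕ t′
  cut-≤ {g = g} {t} {t′} gt gt′ = ≮⇒≥ λ t′<t →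
    let (j , j≡t′) = pointBelow t t′<t
        gj : g j ≡ true
        gj = trans (gt j) (⇒⌊⌋≡true _ (subst (_< toℕ t) (sym j≡t′) t′<t))
        j<t′ = ⌊⌋≡true⇒ (toℕ j <? toℕ t′) (trans (sym (gt′ j)) gj)
    in <-irrefl j≡t′ j<t′

upCut-exists : (f : Fin n → Bool) →
               (∀ {j j′} → toℕ j ≤ toℕ j′ → f j ≡ true → f j′ ≡ true) →
               Σ[ t ∈ Fin (ℕ.suc n) ] f IsUpCutAt t
upCut-exists {ℕ.zero} f _ = zero , λ ()
upCut-exists {ℕ.suc n} f up with f zero in f0
... | true = zero , λ j → up z≤n f0
... | false =
  let (t , cut) = upCut-exists (f ∘ suc) (up ∘ s≤s)
  in suc t , λ where
       zero → f0
       (suc j) → trans (cut j) (sym (⌊≤?⌋-suc (toℕ t) (toℕ j)))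

downCut-exists : (g : Fin n → Bool) →
                 (∀ {j j′} → toℕ j ≤ toℕ j′ → g j′ ≡ true → g j ≡ true) →
                 Σ[ t ∈ Fin (ℕ.suc n) ] g IsDownCutAt t
downCut-exists {ℕ.zero} g _ = zero , λ ()
downCut-exists {ℕ.suc n} g down with g zero in g0
... | false = zero , λ j → ¬-not λ gj → contradiction (trans (sym (down z≤n gj)) g0) λ ()
... | true =
  let (t , cut) = downCut-exists (g ∘ suc) (down ∘ s≤s)
  in suc t , λ where
       zero → g0
       (suc j) → trans (cut j) (sym (⌊≤?⌋-suc (ℕ.suc (toℕ j)) (toℕ t)))

record Cuts (R : RelAC m n) (S : RelCA m n) : Set where
  field
    r s : Fin m → Fin (ℕ.suc n)
    R-cut : ∀ i → R i IsUpCutAt r i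
    S-cut : ∀ i → flip S i IsDownCutAt s i

  R⇒ : ∀ {i j} → R i j ≡ true → toℕ (r i) ≤ toℕ j
  R⇒ {i} {j} Rij = ⌊⌋≡true⇒ (toℕ (r i) ≤? toℕ j) (trans (sym (R-cut i j)) Rij)

  ⇒R : ∀ {i j} → toℕ (r i) ≤ toℕ j → R i j ≡ true
  ⇒R {i} {j} ri≤j = trans (R-cut i j) (⇒⌊⌋≡true _ ri≤j)

  S⇒ : ∀ {i j} → S j i ≡ true → toℕ j < toℕ (s i)
  S⇒ {i} {j} Sji = ⌊⌋≡true⇒ (toℕ j <? toℕ (s i)) (trans (sym (S-cut i j)) Sji)

  ⇒S : ∀ {i j} → toℕ j < toℕ (s i) → S j i ≡ true
  ⇒S {i} {j} j<si = trans (S-cut i j) (⇒⌊⌋≡true _ j<si)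

module _ {R : RelAC m n} {S : RelCA m n} (cuts : Cuts R S) where
  open Cuts cuts

  cuts⇒properMerging : (∀ i i′ → toℕ (s i′) ≤ toℕ (r i)) → IsProperMerging R S
  cuts⇒properMerging s≤r = (reflexive , transitive) , λ i j (Rij , Sji) → disjoint Rij Sji
    where
    disjoint : ∀ {i i′ j} → R i j ≡ true → S j i′ ≡ true → ⊥
    disjoint {i} {i′} Rij Sji′ =
      <-irrefl refl (<-≤-trans (S⇒ Sji′) (≤-trans (s≤r i i′) (R⇒ Rij)))

    reflexive : ∀ x → Merged R S x x
    reflexive (inj₁ i) = refl
    reflexive (inj₂ j) = ≤-refl

    transitive : ∀ x y z → Merged R S x y → Merged R S y z → Merged R S x z
    transitive (inj₁ _) (inj₁ _) (inj₁ _) refl i≡i′ = i≡i′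
    transitive (inj₁ _) (inj₁ _) (inj₂ _) refl Rij = Rij
    transitive (inj₁ _) (inj₂ _) (inj₁ _) Rij Sji′ = contradiction Sji′ (disjoint Rij)
    transitive (inj₁ _) (inj₂ _) (inj₂ _) Rij j≤j′ = ⇒R (≤-trans (R⇒ Rij) j≤j′)
    transitive (inj₂ _) (inj₁ _) (inj₁ _) Sji refl = Sji
    transitive (inj₂ _) (inj₁ i) (inj₂ _) Sji Rij′ =
      <⇒≤ (<-≤-trans (S⇒ Sji) (≤-trans (s≤r i i) (R⇒ Rij′)))
    transitive (inj₂ _) (inj₂ _) (inj₁ _) j≤j′ Sj′i = ⇒S (≤-<-trans j≤j′ (S⇒ Sj′i))
    transitive (inj₂ _) (inj₂ _) (inj₂ _) j≤j′ j′≤j″ = ≤-trans j≤j′ j′≤j″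

  properMerging⇒s≤r : IsProperMerging R S → ∀ i i′ → toℕ (s i′) ≤ toℕ (r i)
  properMerging⇒s≤r ((_ , transitive) , proper) i i′ = ≮⇒≥ λ ri<si′ →
    let (j , j≡ri) = pointBelow (s i′) ri<si′
        Rij = ⇒R (≤-reflexive (sym j≡ri))
        Sji′ = ⇒S (subst (_< toℕ (s i′)) (sym j≡ri) ri<si′)
        i≡i′ = transitive (inj₁ i) (inj₂ j) (inj₁ i′) Rij Sji′
    in proper i j (Rij , subst (λ k → S j k ≡ true) (sym i≡i′) Sji′)

module _ {R R′ : RelAC m n} {S S′ : RelCA m n} (c : Cuts R S) (c′ : Cuts R′ S′) where
  open Cuts

  sameCuts⇒samePair : (∀ i → r c i ≡ r c′ i) → (∀ i → s c i ≡ s c′ i) →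
                      SamePair (R , S) (R′ , S′)
  sameCuts⇒samePair r≡ s≡ =
    (λ i j → trans (R-cut c i j)
               (trans (cong (λ t → ⌊ toℕ t ≤? toℕ j ⌋) (r≡ i)) (sym (R-cut c′ i j)))) ,
    (λ j i → trans (S-cut c i j)
               (trans (cong (λ t → ⌊ toℕ j <? toℕ t ⌋) (s≡ i)) (sym (S-cut c′ i j))))

  samePair⇒sameCuts : SamePair (R , S) (R′ , S′) →
                      (∀ i → r c i ≡ r c′ i) × (∀ i → s c i ≡ s c′ i)
  samePair⇒sameCuts (R≡ , S≡) =
    (λ i → upCut-unique (R-cut c i) λ j → trans (R≡ i j) (R-cut c′ i j)) ,
    (λ i → downCut-unique (S-cut c i) λ j → trans (S≡ j i) (S-cut c′ i j))

properMerging⇒cuts : {R : RelAC m n} {S : RelCA m n} → IsProperMerging R S → Cuts R S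
properMerging⇒cuts {R = R} {S} ((_ , transitive) , _) = record
  { R-cut = λ i → proj₂ (row i)
  ; S-cut = λ i → proj₂ (column i)
  }
  where
  row : ∀ i → Σ[ t ∈ _ ] R i IsUpCutAt t
  row i = upCut-exists (R i) λ j≤j′ Rij → transitive (inj₁ i) (inj₂ _) (inj₂ _) Rij j≤j′

  column : ∀ i → Σ[ t ∈ _ ] flip S i IsDownCutAt t
  column i = downCut-exists (flip S i) λ j≤j′ Sj′i → transitive (inj₂ _) (inj₂ _) (inj₁ i) j≤j′ Sj′i

Φ-cuts : (γ : Coloring m n) → Cuts (Rγ γ) (Sγ γ)
Φ-cuts {n = n} γ = record
  { r = opposite ∘ γ ∘ inj₁
  ; s = opposite ∘ γ ∘ inj₂
  ; R-cut = R-cut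
  ; S-cut = S-cut
  }
  where
  open ≡-Reasoning

  -- opposite-prop states toℕ (opposite c) ≡ suc n ∸ suc (toℕ c), definitionally n ∸ toℕ c.
  R-cut : ∀ i → Rγ γ i IsUpCutAt opposite (γ (inj₁ i))
  R-cut i j = begin
    ⌊ n + 2 ∸ colour γ (inj₁ i) ≤? ℕ.suc (toℕ j) ⌋
      ≡⟨ cong (λ a → ⌊ a ≤? ℕ.suc (toℕ j) ⌋) n+2∸[1+x]≡1+[n∸x] ⟩
    ⌊ ℕ.suc (n ∸ x) ≤? ℕ.suc (toℕ j) ⌋
      ≡⟨ ⌊≤?⌋-suc (n ∸ x) (toℕ j) ⟩
    ⌊ n ∸ x ≤? toℕ j ⌋
      ≡⟨ cong (λ a → ⌊ a ≤? toℕ j ⌋) (sym (opposite-prop (γ (inj₁ i)))) ⟩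
    ⌊ toℕ (opposite (γ (inj₁ i))) ≤? toℕ j ⌋ ∎
    where
    x = toℕ (γ (inj₁ i))
    n+2∸[1+x]≡1+[n∸x] : n + 2 ∸ ℕ.suc x ≡ ℕ.suc (n ∸ x)
    n+2∸[1+x]≡1+[n∸x] =
      trans (cong (_∸ ℕ.suc x) (+-comm n 2)) (+-∸-assoc 1 (toℕ≤pred[n] (γ (inj₁ i))))

  S-cut : ∀ i → flip (Sγ γ) i IsDownCutAt opposite (γ (inj₂ i))
  S-cut i j = cong (λ a → ⌊ ℕ.suc (toℕ j) ≤? a ⌋)
    (trans (cong (_∸ colour γ (inj₂ i)) (+-comm n 1)) (sym (opposite-prop (γ (inj₂ i)))))

Φ-injective : (γ δ : Coloring m n) → SamePair (Φ γ) (Φ δ) → γ ≗C δ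
Φ-injective γ δ same (inj₁ i) = opposite-injective (proj₁ sameCuts i)
  where sameCuts = samePair⇒sameCuts (Φ-cuts γ) (Φ-cuts δ) same
Φ-injective γ δ same (inj₂ i) = opposite-injective (proj₂ sameCuts i)
  where sameCuts = samePair⇒sameCuts (Φ-cuts γ) (Φ-cuts δ) same

Φ-surjective : (R : RelAC m n) (S : RelCA m n) → IsProperMerging R S →
               Σ (Coloring m n) (λ γ → IsMonotoneColoring m n γ × SamePair (Φ γ) (R , S))
Φ-surjective {m} {n} R S proper = γ , monotone , same
  where
  cuts = properMerging⇒cuts proper
  open Cuts cuts

  γ : Coloring m n
  γ = [ opposite ∘ r , opposite ∘ s ]′

  monotone : IsMonotoneColoring m n γ
  monotone (inj₁ i) (inj₂ i′) _ = opposite-anti-≤ (properMerging⇒s≤r cuts proper i i′)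
  monotone (inj₁ _) (inj₁ _) ()
  monotone (inj₂ _) (inj₁ _) ()
  monotone (inj₂ _) (inj₂ _) ()

  same : SamePair (Φ γ) (R , S)
  same = sameCuts⇒samePair (Φ-cuts γ) cuts (opposite-involutive ∘ r) (opposite-involutive ∘ s)

theorem5p6 : (m n : ℕ) →
    ((γ : Coloring m n) → IsMonotoneColoring m n γ →
       IsProperMerging (Rγ γ) (Sγ γ))
    × ((γ δ : Coloring m n) → IsMonotoneColoring m n γ → IsMonotoneColoring m n δ →
       SamePair (Φ γ) (Φ δ) → γ ≗C δ)
    × ((R : RelAC m n) (S : RelCA m n) → IsProperMerging R S →
       Σ (Coloring m n) (λ γ → IsMonotoneColoring m n γ × SamePair (Φ γ) (R , S)))
theorem5p6 m n =
  (λ γ monotone →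
     cuts⇒properMerging (Φ-cuts γ) λ i i′ → opposite-anti-≤ (monotone (inj₁ i) (inj₂ i′) tt)) ,
  (λ γ δ _ _ → Φ-injective γ δ) ,
  Φ-surjective
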